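{- Let $k \geq 2$ be an integer and $r \in \mathbb{N}$. For any $x_1, \dots, x_r \in \mathbb{Q}$ there exists a constant $C \geq 0$ such that the following is true. Let $\alpha_1, \dots, \alpha_r \in \mathbb{N}_0$ and suppose that $\sum_{i=1}^r x_i k^{\alpha_i} = 0$. Then there exist a partition $\{1,\dots,r\} = I_1 \cup \dots \cup I_s$ and $\gamma_1, \dots, \gamma_s \in \mathbb{N}_0$ such that $\sum_{i \in I_j} x_i k^{\alpha_i} = 0$ for all $j \in \{1,\dots,s\}$, and $|\gamma_j - \alpha_i| < C$ for all $i \in I_j$, $j \in \{1,\dots,s\}$.
   Context: $\mathbb{N}_0=\mathbb{N}\cup\{0\}$. -}

module Defs where

open import Data.Nat using (ℕ; zero; suc; _^_)
open import Data.Integer using (+_)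
open import Data.Fin using (Fin; zero; suc; _≟_)
open import Data.Rational using (ℚ; 0ℚ; _+_; _*_; _/_)
open import Relation.Nullary using (does)
open import Data.Bool using (if_then_else_)

sumℚ : (r : ℕ) → (Fin r → ℚ) → ℚ
sumℚ zero f = 0ℚ
sumℚ (suc r) f = f zero + sumℚ r (λ i → f (suc i))

ℕtoℚ : ℕ → ℚ
ℕtoℚ n = + n / 1

term : (k r : ℕ) → (Fin r → ℚ) → (Fin r → ℕ) → Fin r → ℚ
term k r x α i = x i * ℕtoℚ (k ^ α i)

-- Σ_{i ∈ I_j} x_i k^{α_i}, where I_j = { i | block i = j }
blockSum : (k r s : ℕ) → (Fin r → ℚ) → (Fin r → ℕ) → (Fin r → Fin s) → Fin s → ℚ
blockSum k r s x α block j =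
  sumℚ r (λ i → if does (block i ≟ j) then term k r x α i else 0ℚ)

-- Clear denominators, so that d·x_i = a_i ∈ ℤ, and put D = 1 + Σ|a_i|; then Σ|a_i| < k^D.
-- Call t a cut if no exponent lies in the window [t − D, t). For a cut t the part of
-- Σ a_i k^{α_i} with α_i < t is minus the part with α_i ≥ t, hence divisible by k^t, yet its
-- absolute value is at most Σ|a_i| k^{t−D−1} < k^t; so it vanishes. Labelling each index by
-- the greatest cut below α_i, a block is the difference of the parts below two consecutive
-- cuts and sums to zero. No point strictly between a label and the exponents of its block is
-- a cut, so every window [label + mD, label + (m+1)D) below such an exponent contains some
-- α_j; by pigeonhole at most r of them fit, which bounds α_i − label by (r + 1)·D.

module Submission where

open import Defs
open import Algebra.Bundles using (CommutativeMonoid)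
import Algebra.Properties.CommutativeMonoid.Sum as MonoidSum
import Algebra.Properties.Semiring.Sum as SemiringSum
open import Data.Bool using (if_then_else_)
open import Data.Empty using (⊥-elim)
open import Data.Fin using (Fin; zero; suc; toℕ; _≟_)
open import Data.Fin.Properties using (any?; all?; ¬∀⟶∃¬; pigeonhole; toℕ≤pred[n])
open import Data.Integer as ℤ using (ℤ; +_; 0ℤ; ∣_∣)
import Data.Integer.Divisibility.Signed as ℤ
import Data.Integer.Properties as ℤ
open import Data.Integer.Tactic.RingSolver using (solve-∀)
open import Data.Nat as ℕ using (ℕ; zero; suc; _+_; _*_; _∸_; _^_; _≤_; _<_; ∣_-_∣; z≤n; NonZero; _<?_; _≤?_)
import Data.Nat.Divisibility as ℕ
import Data.Nat.Properties as ℕ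
open import Data.Product using (Σ; _×_; _,_; proj₁; proj₂)
open import Data.Rational as ℚ using (ℚ; 0ℚ; 1ℚ; mkℚ; ↥_; ↧ₙ_; toℚᵘ)
import Data.Rational.Properties as ℚ
open import Data.Rational.Unnormalised as ℚᵘ using (mkℚᵘ; *≡*; _≃_)
import Data.Rational.Unnormalised.Properties as ℚᵘ
open import Data.Sum using (_⊎_; inj₁; inj₂; [_,_]′)
open import Data.Sum.Function.Propositional using (_⊎-⇔_)
open import Data.Unit using (tt)
open import Function.Base using (_∘_)
open import Function.Bundles using (_⇔_; mk⇔; Equivalence)
open import Function.Definitions using (Surjective; Injective)
import Function.Properties.Equivalence as ⇔
open import Level using (0ℓ)
open import Relation.Binary.Definitions using (DecidableEquality)
open import Relation.Binary.PropositionalEquality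
open import Relation.Nullary using (Dec; yes; no; does; ¬_)
open import Relation.Nullary.Decidable using (_⊎-dec_)
open import Relation.Unary using (Pred; Decidable)

open import Algebra.Properties.CommutativeSemigroup
  (CommutativeMonoid.commutativeSemigroup ℚ.*-1-commutativeMonoid) using (x∙yz≈y∙xz; xy∙z≈xz∙y)

module Search {p} {P : Pred ℕ p} (P? : Decidable P) where

  greatestUpTo : ℕ → ℕ
  greatestUpTo zero = zero
  greatestUpTo (suc n) with P? (suc n)
  ... | yes _ = suc n
  ... | no  _ = greatestUpTo n

  greatestUpTo-≤ : ∀ n → greatestUpTo n ≤ n
  greatestUpTo-≤ zero = z≤n
  greatestUpTo-≤ (suc n) with P? (suc n)
  ... | yes _ = ℕ.≤-refl
  ... | no  _ = ℕ.m≤n⇒m≤1+n (greatestUpTo-≤ n)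

  greatestUpTo-holds : P 0 → ∀ n → P (greatestUpTo n)
  greatestUpTo-holds P0 zero = P0
  greatestUpTo-holds P0 (suc n) with P? (suc n)
  ... | yes Pn = Pn
  ... | no  _  = greatestUpTo-holds P0 n

  greatestUpTo-greatest : ∀ {t} n → P t → t ≤ n → t ≤ greatestUpTo n
  greatestUpTo-greatest zero _ t≤0 = t≤0
  greatestUpTo-greatest (suc n) Pt t≤1+n with P? (suc n)
  ... | yes _ = t≤1+n
  ... | no ¬P with ℕ.m≤n⇒m<n∨m≡n t≤1+n
  ...   | inj₁ t<1+n = greatestUpTo-greatest n Pt (ℕ.≤-pred t<1+n)
  ...   | inj₂ refl  = ⊥-elim (¬P Pt)

  leastFrom : ℕ → ℕ → ℕ
  leastFrom w zero = w
  leastFrom w (suc f) with P? w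
  ... | yes _ = w
  ... | no  _ = leastFrom (suc w) f

  leastFrom-≥ : ∀ w f → w ≤ leastFrom w f
  leastFrom-≥ w zero = ℕ.≤-refl
  leastFrom-≥ w (suc f) with P? w
  ... | yes _ = ℕ.≤-refl
  ... | no  _ = ℕ.≤-trans (ℕ.n≤1+n w) (leastFrom-≥ (suc w) f)

  leastFrom-holds : ∀ w f → P (w + f) → P (leastFrom w f)
  leastFrom-holds w zero Pw+0 = subst P (ℕ.+-identityʳ w) Pw+0
  leastFrom-holds w (suc f) Pw+f with P? w
  ... | yes Pw = Pw
  ... | no  _  = leastFrom-holds (suc w) f (subst P (ℕ.+-suc w f) Pw+f)

  leastFrom-least : ∀ {t} w f → w ≤ t → P t → leastFrom w f ≤ t
  leastFrom-least w zero w≤t _ = w≤t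
  leastFrom-least w (suc f) w≤t Pt with P? w
  ... | yes _ = w≤t
  ... | no ¬P with ℕ.m≤n⇒m<n∨m≡n w≤t
  ...   | inj₁ w<t = leastFrom-least (suc w) f w<t Pt
  ...   | inj₂ refl = ⊥-elim (¬P Pt)

record Image {a} {A : Set a} {r} (g : Fin r → A) : Set a where
  field
    size : ℕ
    proj : Fin r → Fin size
    incl : Fin size → A
    proj-surjective : Surjective _≡_ _≡_ proj
    incl-injective : Injective _≡_ _≡_ incl
    incl∘proj : ∀ i → incl (proj i) ≡ g i

  proj≡⇔≡incl : ∀ i j → proj i ≡ j ⇔ g i ≡ incl j
  proj≡⇔≡incl i j = mk⇔
    (λ proj≡ → trans (sym (incl∘proj i)) (cong incl proj≡))
    (λ g≡incl → incl-injective (trans (incl∘proj i) g≡incl))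

  incl∈image : ∀ j → Σ (Fin r) λ i → g i ≡ incl j
  incl∈image j with proj-surjective j
  ... | i , proj≡ = i , Equivalence.to (proj≡⇔≡incl i j) (proj≡ refl)

image : ∀ {a} {A : Set a} → DecidableEquality A → ∀ {r} (g : Fin r → A) → Image g
image _≟_ {zero} g = record
  { size = 0 ; proj = λ () ; incl = λ () ; proj-surjective = λ ()
  ; incl-injective = λ { {()} } ; incl∘proj = λ () }
image _≟_ {suc r} g with image _≟_ (λ i → g (suc i))
... | im with any? (λ j → Image.incl im j ≟ g zero)
...   | yes (j₀ , incl-j₀) = record
  { size = size
  ; proj = λ { zero → j₀ ; (suc i) → proj i }
  ; incl = incl
  ; proj-surjective = λ j →
      suc (proj₁ (proj-surjective j)) , λ { refl → proj₂ (proj-surjective j) refl }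
  ; incl-injective = incl-injective
  ; incl∘proj = λ { zero → incl-j₀ ; (suc i) → incl∘proj i } }
  where open Image im
...   | no g₀-new = record
  { size = suc size
  ; proj = λ { zero → zero ; (suc i) → suc (proj i) }
  ; incl = incl′
  ; proj-surjective = surjective
  ; incl-injective = injective
  ; incl∘proj = λ { zero → refl ; (suc i) → incl∘proj i } }
  where
  open Image im
  incl′ : Fin (suc size) → _
  incl′ zero = g zero
  incl′ (suc j) = incl j
  surjective : Surjective _≡_ _≡_ _
  surjective zero = zero , λ { refl → refl }
  surjective (suc j) =
    suc (proj₁ (proj-surjective j)) , λ { refl → cong suc (proj₂ (proj-surjective j) refl) }
  injective : Injective _≡_ _≡_ incl′
  injective {zero} {zero} _ = refl
  injective {zero} {suc j} eq = ⊥-elim (g₀-new (j , sym eq))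
  injective {suc j} {zero} eq = ⊥-elim (g₀-new (j , eq))
  injective {suc j} {suc j′} eq = cong suc (incl-injective eq)

ι : ℤ → ℚ
ι i = i ℚ./ 1

toℚᵘ-ι : ∀ i → toℚᵘ (ι i) ≃ mkℚᵘ i 0
toℚᵘ-ι i = ℚ.toℚᵘ-fromℚᵘ (mkℚᵘ i 0)

ι-+ : ∀ i j → ι (i ℤ.+ j) ≡ ι i ℚ.+ ι j
ι-+ i j = ℚ.toℚᵘ-injective (begin
  toℚᵘ (ι (i ℤ.+ j))             ≈⟨ toℚᵘ-ι (i ℤ.+ j) ⟩
  mkℚᵘ (i ℤ.+ j) 0               ≈⟨ *≡* (cross i j) ⟩
  mkℚᵘ i 0 ℚᵘ.+ mkℚᵘ j 0         ≈⟨ ℚᵘ.+-cong (toℚᵘ-ι i) (toℚᵘ-ι j) ⟨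
  toℚᵘ (ι i) ℚᵘ.+ toℚᵘ (ι j)     ≈⟨ ℚ.toℚᵘ-homo-+ (ι i) (ι j) ⟨
  toℚᵘ (ι i ℚ.+ ι j)             ∎)
  where
  open ℚᵘ.≃-Reasoning
  cross : ∀ i j → (i ℤ.+ j) ℤ.* (+ 1 ℤ.* + 1) ≡ (i ℤ.* + 1 ℤ.+ j ℤ.* + 1) ℤ.* + 1
  cross = solve-∀

ι-* : ∀ i j → ι (i ℤ.* j) ≡ ι i ℚ.* ι j
ι-* i j = ℚ.toℚᵘ-injective (begin
  toℚᵘ (ι (i ℤ.* j))             ≈⟨ toℚᵘ-ι (i ℤ.* j) ⟩
  mkℚᵘ (i ℤ.* j) 0               ≈⟨ *≡* (cross i j) ⟩
  mkℚᵘ i 0 ℚᵘ.* mkℚᵘ j 0         ≈⟨ ℚᵘ.*-cong (toℚᵘ-ι i) (toℚᵘ-ι j) ⟨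
  toℚᵘ (ι i) ℚᵘ.* toℚᵘ (ι j)     ≈⟨ ℚ.toℚᵘ-homo-* (ι i) (ι j) ⟨
  toℚᵘ (ι i ℚ.* ι j)             ∎)
  where
  open ℚᵘ.≃-Reasoning
  cross : ∀ i j → (i ℤ.* j) ℤ.* (+ 1 ℤ.* + 1) ≡ (i ℤ.* j) ℤ.* + 1
  cross = solve-∀

ι-injective : Injective _≡_ _≡_ ι
ι-injective {i} {j} ιi≡ιj = begin
  i             ≡⟨ ℤ.*-identityʳ i ⟨
  i ℤ.* + 1     ≡⟨ ℚᵘ.drop-*≡* i≃j ⟩
  j ℤ.* + 1     ≡⟨ ℤ.*-identityʳ j ⟩
  j             ∎
  where
  open ≡-Reasoning
  i≃j : mkℚᵘ i 0 ≃ mkℚᵘ j 0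
  i≃j = ℚᵘ.≃-trans (ℚᵘ.≃-sym (toℚᵘ-ι i)) (ℚᵘ.≃-trans (ℚ.toℚᵘ-cong ιi≡ιj) (toℚᵘ-ι j))

ι-pos-* : ∀ m n → ι (+ (m * n)) ≡ ι (+ m) ℚ.* ι (+ n)
ι-pos-* m n = trans (cong ι (ℤ.pos-* m n)) (ι-* (+ m) (+ n))

p*↧p≡↥p : ∀ p → p ℚ.* ι (+ ↧ₙ p) ≡ ι (↥ p)
p*↧p≡↥p p@(mkℚ n d-1 _) = ℚ.toℚᵘ-injective (begin
  toℚᵘ (p ℚ.* ι (+ ↧ₙ p))              ≈⟨ ℚ.toℚᵘ-homo-* p (ι (+ ↧ₙ p)) ⟩
  mkℚᵘ n d-1 ℚᵘ.* toℚᵘ (ι (+ ↧ₙ p))    ≈⟨ ℚᵘ.*-congˡ {mkℚᵘ n d-1} (toℚᵘ-ι (+ ↧ₙ p)) ⟩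
  mkℚᵘ n d-1 ℚᵘ.* mkℚᵘ (+ ↧ₙ p) 0      ≈⟨ *≡* (cross n (+ ↧ₙ p)) ⟩
  mkℚᵘ n 0                             ≈⟨ toℚᵘ-ι n ⟨
  toℚᵘ (ι n)                           ∎)
  where
  open ℚᵘ.≃-Reasoning
  cross : ∀ n d → (n ℤ.* d) ℤ.* + 1 ≡ n ℤ.* (d ℤ.* + 1)
  cross = solve-∀

p*q≡0⇒p≡0 : ∀ {p q} → q ≢ 0ℚ → p ℚ.* q ≡ 0ℚ → p ≡ 0ℚ
p*q≡0⇒p≡0 {p} {q} q≢0 pq≡0 = begin
  p                         ≡⟨ ℚ.*-identityʳ p ⟨
  p ℚ.* 1ℚ                  ≡⟨ cong (p ℚ.*_) (ℚ.*-inverseʳ q) ⟨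
  p ℚ.* (q ℚ.* ℚ.1/ q)      ≡⟨ ℚ.*-assoc p q (ℚ.1/ q) ⟨
  (p ℚ.* q) ℚ.* ℚ.1/ q      ≡⟨ cong (ℚ._* ℚ.1/ q) pq≡0 ⟩
  0ℚ ℚ.* ℚ.1/ q             ≡⟨ ℚ.*-zeroˡ (ℚ.1/ q) ⟩
  0ℚ                        ∎
  where
  open ≡-Reasoning
  instance _ = ℚ.≢-nonZero q≢0

record CommonDenominator {r} (x : Fin r → ℚ) : Set where
  field
    denominator : ℕ
    denominator≢0 : NonZero denominator
    numerator : Fin r → ℤ
    x*denominator≡numerator : ∀ i → x i ℚ.* ι (+ denominator) ≡ ι (numerator i)

commonDenominator : ∀ {r} (x : Fin r → ℚ) → CommonDenominator x
commonDenominator {zero} x = record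
  { denominator = 1 ; denominator≢0 = _ ; numerator = λ () ; x*denominator≡numerator = λ () }
commonDenominator {suc r} x = record
  { denominator = e * d
  ; denominator≢0 = ℕ.m*n≢0 e d {{_}} {{d≢0}}
  ; numerator = λ { zero → ↥ (x zero) ℤ.* + d ; (suc i) → + e ℤ.* a i }
  ; x*denominator≡numerator = λ { zero → head ; (suc i) → tail i } }
  where
  open CommonDenominator (commonDenominator (λ i → x (suc i)))
    renaming (denominator to d; denominator≢0 to d≢0; numerator to a; x*denominator≡numerator to xd≡a)
  e = ↧ₙ x zero
  open ≡-Reasoning
  head : x zero ℚ.* ι (+ (e * d)) ≡ ι (↥ (x zero) ℤ.* + d)
  head = begin
    x zero ℚ.* ι (+ (e * d))              ≡⟨ cong (x zero ℚ.*_) (ι-pos-* e d) ⟩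
    x zero ℚ.* (ι (+ e) ℚ.* ι (+ d))        ≡⟨ ℚ.*-assoc (x zero) (ι (+ e)) (ι (+ d)) ⟨
    (x zero ℚ.* ι (+ e)) ℚ.* ι (+ d)        ≡⟨ cong (ℚ._* ι (+ d)) (p*↧p≡↥p (x zero)) ⟩
    ι (↥ (x zero)) ℚ.* ι (+ d)              ≡⟨ ι-* (↥ (x zero)) (+ d) ⟨
    ι (↥ (x zero) ℤ.* + d)                  ∎
  tail : ∀ i → x (suc i) ℚ.* ι (+ (e * d)) ≡ ι (+ e ℤ.* a i)
  tail i = begin
    x (suc i) ℚ.* ι (+ (e * d))           ≡⟨ cong (x (suc i) ℚ.*_) (ι-pos-* e d) ⟩
    x (suc i) ℚ.* (ι (+ e) ℚ.* ι (+ d))     ≡⟨ x∙yz≈y∙xz (x (suc i)) (ι (+ e)) (ι (+ d)) ⟩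
    ι (+ e) ℚ.* (x (suc i) ℚ.* ι (+ d))     ≡⟨ cong (ι (+ e) ℚ.*_) (xd≡a i) ⟩
    ι (+ e) ℚ.* ι (a i)                     ≡⟨ ι-* (+ e) (a i) ⟨
    ι (+ e ℤ.* a i)                         ∎

module ℤΣ = MonoidSum ℤ.+-0-commutativeMonoid
module ℕΣ = SemiringSum ℕ.+-*-semiring

∣-sum : ∀ {n m} (f : Fin n → ℤ) → (∀ i → m ℤ.∣ f i) → m ℤ.∣ ℤΣ.sum f
∣-sum {zero} f _ = ℤ.divides 0ℤ refl
∣-sum {suc n} f m∣f = ℤ.∣m∣n⇒∣m+n (m∣f zero) (∣-sum (λ i → f (suc i)) (λ i → m∣f (suc i)))

∣sum∣≤sum∣∣ : ∀ {n} (f : Fin n → ℤ) → ∣ ℤΣ.sum f ∣ ≤ ℕΣ.sum (λ i → ∣ f i ∣)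
∣sum∣≤sum∣∣ {zero} f = z≤n
∣sum∣≤sum∣∣ {suc n} f = ℕ.≤-trans (ℤ.∣i+j∣≤∣i∣+∣j∣ (f zero) _)
  (ℕ.+-monoʳ-≤ ∣ f zero ∣ (∣sum∣≤sum∣∣ (λ i → f (suc i))))

sum-mono-≤ : ∀ {n} {f g : Fin n → ℕ} → (∀ i → f i ≤ g i) → ℕΣ.sum f ≤ ℕΣ.sum g
sum-mono-≤ {zero} _ = z≤n
sum-mono-≤ {suc n} f≤g = ℕ.+-mono-≤ (f≤g zero) (sum-mono-≤ (λ i → f≤g (suc i)))

≤sum : ∀ {n} (f : Fin n → ℕ) i → f i ≤ ℕΣ.sum f
≤sum f zero = ℕ.m≤m+n (f zero) _
≤sum f (suc i) = ℕ.≤-trans (≤sum (λ i → f (suc i)) i) (ℕ.m≤n+m _ (f zero))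

∣∧<⇒≡0 : ∀ {m n} → m ℕ.∣ n → n < m → n ≡ 0
∣∧<⇒≡0 {n = zero} _ _ = refl
∣∧<⇒≡0 {n = suc n} m∣n n<m = ⊥-elim (ℕ.>⇒∤ n<m m∣n)

^-monoʳ-∣ : ∀ k {m n} → m ≤ n → k ^ m ℕ.∣ k ^ n
^-monoʳ-∣ k {m} {n} m≤n = ℕ.divides (k ^ (n ∸ m))
  (trans (cong (k ^_) (sym (ℕ.m∸n+n≡m m≤n))) (ℕ.^-distribˡ-+-* k (n ∸ m) m))

select : ∀ {p} {P : Set p} → Dec P → ℤ → ℤ
select P? z = if does P? then z else 0ℤ

select-⊎ : ∀ {p q r} {P : Set p} {Q : Set q} {R : Set r} (P? : Dec P) (Q? : Dec Q) (R? : Dec R) →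
  R ⇔ (P ⊎ Q) → ¬ (P × Q) → ∀ z → select R? z ≡ select P? z ℤ.+ select Q? z
select-⊎ P? Q? R? R⇔P⊎Q disjoint z with P? | Q? | R?
... | yes p | yes q | _     = ⊥-elim (disjoint (p , q))
... | yes _ | no _  | yes _ = sym (ℤ.+-identityʳ z)
... | no _  | yes _ | yes _ = sym (ℤ.+-identityˡ z)
... | no _  | no _  | no _  = refl
... | yes p | no _  | no ¬r = ⊥-elim (¬r (Equivalence.from R⇔P⊎Q (inj₁ p)))
... | no _  | yes q | no ¬r = ⊥-elim (¬r (Equivalence.from R⇔P⊎Q (inj₂ q)))
... | no ¬p | no ¬q | yes r = ⊥-elim ([ ¬p , ¬q ]′ (Equivalence.to R⇔P⊎Q r))

select-ι : ∀ {p} {P : Set p} (P? : Dec P) {t q z} → t ℚ.* q ≡ ι z →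
  (if does P? then t else 0ℚ) ℚ.* q ≡ ι (select P? z)
select-ι (yes _) tq≡z = tq≡z
select-ι (no _) {q = q} _ = ℚ.*-zeroˡ q

sumℚ-*-ι : ∀ r {q} (f : Fin r → ℚ) (z : Fin r → ℤ) → (∀ i → f i ℚ.* q ≡ ι (z i)) →
  sumℚ r f ℚ.* q ≡ ι (ℤΣ.sum z)
sumℚ-*-ι zero {q} _ _ _ = ℚ.*-zeroˡ q
sumℚ-*-ι (suc r) {q} f z fq≡z = begin
  (f zero ℚ.+ sumℚ r (f ∘ suc)) ℚ.* q             ≡⟨ ℚ.*-distribʳ-+ q (f zero) (sumℚ r (f ∘ suc)) ⟩
  f zero ℚ.* q ℚ.+ sumℚ r (f ∘ suc) ℚ.* q         ≡⟨ cong₂ ℚ._+_ (fq≡z zero) (sumℚ-*-ι r (f ∘ suc) (z ∘ suc) (fq≡z ∘ suc)) ⟩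
  ι (z zero) ℚ.+ ι (ℤΣ.sum (z ∘ suc))             ≡⟨ ι-+ (z zero) (ℤΣ.sum (z ∘ suc)) ⟨
  ι (ℤΣ.sum z)                                    ∎
  where open ≡-Reasoning

n<k^n : ∀ {k} → 1 < k → ∀ n → n < k ^ n
n<k^n 1<k zero = ℕ.s≤s ℕ.z≤n
n<k^n {k} 1<k (suc n) = ℕ.≤-<-trans (n<k^n 1<k n) (ℕ.^-monoʳ-< k 1<k (ℕ.n<1+n n))

module Cuts {r} (α : Fin r → ℕ) (D : ℕ) where

  IsCut : Pred ℕ 0ℓ
  IsCut t = ∀ j → α j + D < t ⊎ t ≤ α j

  isCut? : Decidable IsCut
  isCut? t = all? λ j → (α j + D <? t) ⊎-dec (t ≤? α j)

  open Search isCut?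

  floorCut : ℕ → ℕ
  floorCut = greatestUpTo

  nextCut : ℕ → ℕ
  nextCut v = leastFrom (suc v) (suc (ℕΣ.sum α + D))

  floorCut-≤ : ∀ n → floorCut n ≤ n
  floorCut-≤ = greatestUpTo-≤

  floorCut-isCut : ∀ n → IsCut (floorCut n)
  floorCut-isCut = greatestUpTo-holds (λ _ → inj₂ z≤n)

  isCut⇒≤floorCut : ∀ {t n} → IsCut t → t ≤ n → t ≤ floorCut n
  isCut⇒≤floorCut = greatestUpTo-greatest _

  <nextCut : ∀ v → v < nextCut v
  <nextCut v = leastFrom-≥ (suc v) _

  nextCut-isCut : ∀ v → IsCut (nextCut v)
  nextCut-isCut v = leastFrom-holds (suc v) _ λ j →
    inj₁ (ℕ.≤-trans (ℕ.s≤s (ℕ.+-monoˡ-≤ D (≤sum α j))) (ℕ.m≤n+m _ (suc v)))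

  nextCut-least : ∀ {v t} → v < t → IsCut t → nextCut v ≤ t
  nextCut-least = leastFrom-least (suc _) _

  <nextCut⇔ : ∀ {v} → IsCut v → ∀ n → n < nextCut v ⇔ (n < v ⊎ floorCut n ≡ v)
  <nextCut⇔ {v} v-cut n = mk⇔ to from
    where
    to : n < nextCut v → n < v ⊎ floorCut n ≡ v
    to n<w with n <? v
    ... | yes n<v = inj₁ n<v
    ... | no n≮v = inj₂ (ℕ.≤-antisym floor≤v (isCut⇒≤floorCut v-cut (ℕ.≮⇒≥ n≮v)))
      where
      floor≤v : floorCut n ≤ v
      floor≤v = ℕ.≮⇒≥ λ v<floor →
        ℕ.<⇒≱ n<w (ℕ.≤-trans (nextCut-least v<floor (floorCut-isCut n)) (floorCut-≤ n))
    from : n < v ⊎ floorCut n ≡ v → n < nextCut v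
    from (inj₁ n<v) = ℕ.<-trans n<v (<nextCut v)
    from (inj₂ floor≡v) = ℕ.≰⇒> λ w≤n →
      ℕ.<⇒≱ (<nextCut v) (subst (nextCut v ≤_) floor≡v (isCut⇒≤floorCut (nextCut-isCut v) w≤n))

  ¬isCut⇒window : ∀ {t} → ¬ IsCut t → Σ (Fin r) λ j → α j < t × t ≤ α j + D
  ¬isCut⇒window {t} ¬cut with ¬∀⟶∃¬ r _ (λ j → (α j + D <? t) ⊎-dec (t ≤? α j)) ¬cut
  ... | j , ¬in-or-out = j , ℕ.≰⇒> (¬in-or-out ∘ inj₂) , ℕ.≮⇒≥ (¬in-or-out ∘ inj₁)

  floorCut-close : .{{NonZero D}} → ∀ n → ∣ floorCut n - n ∣ < suc r * D
  floorCut-close n = begin-strict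
    ∣ g - n ∣    ≡⟨ ℕ.m≤n⇒∣m-n∣≡n∸m (floorCut-≤ n) ⟩
    n ∸ g        <⟨ ℕ.m<n+o⇒m∸n<o n g (ℕ.≰⇒> no-wide-gap) ⟩
    suc r * D    ∎
    where
    open ℕ.≤-Reasoning
    instance _ = ℕ.m*n≢0 (suc r) D
    g = floorCut n
    edge : ℕ → ℕ
    edge m = g + m * D
    edge-suc : ∀ m → edge m + D ≡ edge (suc m)
    edge-suc m = trans (ℕ.+-assoc g (m * D) D) (cong (λ w → g + w) (ℕ.+-comm (m * D) D))
    occupant : edge (suc r) ≤ n → (m : Fin (suc r)) →
      Σ (Fin r) λ j → edge (toℕ m) ≤ α j × α j < edge (suc (toℕ m))
    occupant wide m with ¬isCut⇒window ¬cut
      where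
      ¬cut : ¬ IsCut (edge (suc (toℕ m)))
      ¬cut cut = ℕ.<⇒≱ (ℕ.m<m+n g (ℕ.<-≤-trans (ℕ.>-nonZero⁻¹ D) (ℕ.m≤m+n D _)))
        (isCut⇒≤floorCut cut (ℕ.≤-trans (ℕ.+-monoʳ-≤ g (ℕ.*-monoˡ-≤ D (ℕ.s≤s (toℕ≤pred[n] m)))) wide))
    ... | j , α<top , top≤ =
      j , ℕ.+-cancelʳ-≤ D _ _ (subst (_≤ α j + D) (sym (edge-suc (toℕ m))) top≤) , α<top
    no-wide-gap : ¬ edge (suc r) ≤ n
    no-wide-gap wide with pigeonhole (ℕ.n<1+n r) (proj₁ ∘ occupant wide)
    ... | m , m′ , m<m′ , same = ℕ.<⇒≱ (proj₂ (proj₂ (occupant wide m))) (begin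
      edge (suc (toℕ m))             ≤⟨ ℕ.+-monoʳ-≤ g (ℕ.*-monoˡ-≤ D m<m′) ⟩
      edge (toℕ m′)                  ≤⟨ proj₁ (proj₂ (occupant wide m′)) ⟩
      α (proj₁ (occupant wide m′))   ≡⟨ cong α same ⟨
      α (proj₁ (occupant wide m))    ∎)

module PowerSums {r} (k : ℕ) .{{_ : NonZero k}} (a : Fin r → ℤ) (α : Fin r → ℕ) where

  z : Fin r → ℤ
  z i = a i ℤ.* + (k ^ α i)

  below : ℕ → ℤ
  below t = ℤΣ.sum λ i → select (α i <? t) (z i)

  module _ {D} (Σ∣a∣<k^D : ℕΣ.sum (λ i → ∣ a i ∣) < k ^ D) (Σz≡0 : ℤΣ.sum z ≡ 0ℤ) where

    open Cuts α D

    below-isCut≡0 : ∀ {t} → IsCut t → below t ≡ 0ℤ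
    below-isCut≡0 {t} t-cut = ℤ.∣i∣≡0⇒i≡0 (∣∧<⇒≡0 (ℤ.∣⇒∣ᵤ k^t∣below) ∣below∣<k^t)
      where
      instance _ = ℕ.m^n≢0 k t
      above : ℤ
      above = ℤΣ.sum λ i → select (t ≤? α i) (z i)
      below+above≡0 : below t ℤ.+ above ≡ 0ℤ
      below+above≡0 = begin
        below t ℤ.+ above  ≡⟨ ℤΣ.∑-distrib-+ (λ i → select (α i <? t) (z i)) (λ i → select (t ≤? α i) (z i)) ⟨
        ℤΣ.sum (λ i → select (α i <? t) (z i) ℤ.+ select (t ≤? α i) (z i))
                           ≡⟨ ℤΣ.sum-cong-≗ (λ i → select-⊎ (α i <? t) (t ≤? α i) (yes tt)
                                 (mk⇔ (λ _ → ℕ.<-≤-connex (α i) t) _) (λ (lt , ge) → ℕ.<⇒≱ lt ge) (z i)) ⟨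
        ℤΣ.sum z           ≡⟨ Σz≡0 ⟩
        0ℤ                 ∎
        where open ≡-Reasoning
      k^t∣above : + (k ^ t) ℤ.∣ above
      k^t∣above = ∣-sum _ λ i → k^t∣ i (t ≤? α i)
        where
        k^t∣ : ∀ i (t≤α? : Dec (t ≤ α i)) → + (k ^ t) ℤ.∣ select t≤α? (z i)
        k^t∣ i (yes t≤α) = ℤ.∣n⇒∣m*n (a i) (ℤ.∣ᵤ⇒∣ (^-monoʳ-∣ k t≤α))
        k^t∣ i (no _) = ℤ.divides 0ℤ refl
      k^t∣below : + (k ^ t) ℤ.∣ below t
      k^t∣below = ℤ.∣m+n∣n⇒∣m (subst (+ (k ^ t) ℤ.∣_) (sym below+above≡0) (ℤ.divides 0ℤ refl)) k^t∣above
      term-bound : ∀ i (α<t? : Dec (α i < t)) → ∣ select α<t? (z i) ∣ * k ^ D ≤ ∣ a i ∣ * k ^ t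
      term-bound i (no _) = z≤n
      term-bound i (yes α<t) = begin
        ∣ a i ℤ.* + (k ^ α i) ∣ * k ^ D   ≡⟨ cong (_* k ^ D) (ℤ.∣i*j∣≡∣i∣*∣j∣ (a i) (+ (k ^ α i))) ⟩
        ∣ a i ∣ * k ^ α i * k ^ D         ≡⟨ ℕ.*-assoc ∣ a i ∣ (k ^ α i) (k ^ D) ⟩
        ∣ a i ∣ * (k ^ α i * k ^ D)       ≡⟨ cong (∣ a i ∣ *_) (ℕ.^-distribˡ-+-* k (α i) D) ⟨
        ∣ a i ∣ * k ^ (α i + D)           ≤⟨ ℕ.*-monoʳ-≤ ∣ a i ∣ (ℕ.^-monoʳ-≤ k (ℕ.<⇒≤ α+D<t)) ⟩
        ∣ a i ∣ * k ^ t                   ∎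
        where
        open ℕ.≤-Reasoning
        α+D<t : α i + D < t
        α+D<t = [ (λ lt → lt) , (λ ge → ⊥-elim (ℕ.<⇒≱ α<t ge)) ]′ (t-cut i)
      ∣below∣<k^t : ∣ below t ∣ < k ^ t
      ∣below∣<k^t = ℕ.*-cancelʳ-< (k ^ D) ∣ below t ∣ (k ^ t) (begin-strict
        ∣ below t ∣ * k ^ D                                  ≤⟨ ℕ.*-monoˡ-≤ (k ^ D) (∣sum∣≤sum∣∣ (λ i → select (α i <? t) (z i))) ⟩
        ℕΣ.sum (λ i → ∣ select (α i <? t) (z i) ∣) * k ^ D   ≡⟨ ℕΣ.*-distribʳ-sum (k ^ D) (λ i → ∣ select (α i <? t) (z i) ∣) ⟩
        ℕΣ.sum (λ i → ∣ select (α i <? t) (z i) ∣ * k ^ D)   ≤⟨ sum-mono-≤ (λ i → term-bound i (α i <? t)) ⟩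
        ℕΣ.sum (λ i → ∣ a i ∣ * k ^ t)                       ≡⟨ ℕΣ.*-distribʳ-sum (k ^ t) (λ i → ∣ a i ∣) ⟨
        ℕΣ.sum (λ i → ∣ a i ∣) * k ^ t                       <⟨ ℕ.*-monoˡ-< (k ^ t) Σ∣a∣<k^D ⟩
        k ^ D * k ^ t                                        ≡⟨ ℕ.*-comm (k ^ D) (k ^ t) ⟩
        k ^ t * k ^ D                                        ∎)
        where open ℕ.≤-Reasoning

    fibre-sum≡0 : ∀ {v} → IsCut v → {Q : Pred (Fin r) 0ℓ} (Q? : Decidable Q) →
      (∀ i → Q i ⇔ floorCut (α i) ≡ v) → ℤΣ.sum (λ i → select (Q? i) (z i)) ≡ 0ℤ
    fibre-sum≡0 {v} v-cut Q? Q⇔ = begin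
      fibre                  ≡⟨ ℤ.+-identityˡ fibre ⟨
      0ℤ ℤ.+ fibre           ≡⟨ cong (ℤ._+ fibre) (below-isCut≡0 v-cut) ⟨
      below v ℤ.+ fibre      ≡⟨ ℤΣ.∑-distrib-+ (λ i → select (α i <? v) (z i)) (λ i → select (Q? i) (z i)) ⟨
      ℤΣ.sum (λ i → select (α i <? v) (z i) ℤ.+ select (Q? i) (z i))
                             ≡⟨ ℤΣ.sum-cong-≗ split ⟨
      below (nextCut v)      ≡⟨ below-isCut≡0 (nextCut-isCut v) ⟩
      0ℤ                     ∎
      where
      open ≡-Reasoning
      fibre = ℤΣ.sum λ i → select (Q? i) (z i)
      split : ∀ i → select (α i <? nextCut v) (z i) ≡ select (α i <? v) (z i) ℤ.+ select (Q? i) (z i)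
      split i = select-⊎ (α i <? v) (Q? i) (α i <? nextCut v)
        (⇔.trans (<nextCut⇔ v-cut (α i)) (⇔.refl ⊎-⇔ ⇔.sym (Q⇔ i)))
        (λ (α<v , q) → ℕ.<⇒≱ α<v (subst (_≤ α i) (Equivalence.to (Q⇔ i) q) (floorCut-≤ (α i))))
        (z i)

height : ∀ {r} → (Fin r → ℚ) → ℕ
height x = ℕΣ.sum λ i → ∣ CommonDenominator.numerator (commonDenominator x) i ∣

module BlockDecomposition {r} (k : ℕ) (1<k : 1 < k) (x : Fin r → ℚ) (α : Fin r → ℕ)
  (Σterm≡0 : sumℚ r (term k r x α) ≡ 0ℚ) where

  private instance
    k≢0 : NonZero k
    k≢0 = ℕ.>-nonZero (ℕ.<-trans (ℕ.s≤s z≤n) 1<k)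

  open CommonDenominator (commonDenominator x)
  open PowerSums k numerator α
  open Cuts α (suc (height x))
  open Image (image ℕ._≟_ (floorCut ∘ α)) public

  ιd≢0 : ι (+ denominator) ≢ 0ℚ
  ιd≢0 ιd≡0 = ℕ.≢-nonZero⁻¹ denominator {{denominator≢0}} (ℤ.+-injective (ι-injective ιd≡0))

  term*d≡z : ∀ i → term k r x α i ℚ.* ι (+ denominator) ≡ ι (z i)
  term*d≡z i = begin
    x i ℚ.* ι (+ k ^ α i) ℚ.* ι (+ denominator)   ≡⟨ xy∙z≈xz∙y (x i) (ι (+ k ^ α i)) (ι (+ denominator)) ⟩
    x i ℚ.* ι (+ denominator) ℚ.* ι (+ k ^ α i)   ≡⟨ cong (ℚ._* ι (+ k ^ α i)) (x*denominator≡numerator i) ⟩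
    ι (numerator i) ℚ.* ι (+ k ^ α i)             ≡⟨ ι-* (numerator i) (+ k ^ α i) ⟨
    ι (z i)                                       ∎
    where open ≡-Reasoning

  selected-sum*d : ∀ {P : Pred (Fin r) 0ℓ} (P? : Decidable P) →
    sumℚ r (λ i → if does (P? i) then term k r x α i else 0ℚ) ℚ.* ι (+ denominator)
      ≡ ι (ℤΣ.sum λ i → select (P? i) (z i))
  selected-sum*d P? = sumℚ-*-ι r _ _ λ i → select-ι (P? i) (term*d≡z i)

  Σz≡0 : ℤΣ.sum z ≡ 0ℤ
  Σz≡0 = ι-injective (begin
    ι (ℤΣ.sum z)                                   ≡⟨ selected-sum*d (λ _ → yes tt) ⟨
    sumℚ r (term k r x α) ℚ.* ι (+ denominator)    ≡⟨ cong (ℚ._* ι (+ denominator)) Σterm≡0 ⟩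
    0ℚ ℚ.* ι (+ denominator)                       ≡⟨ ℚ.*-zeroˡ (ι (+ denominator)) ⟩
    0ℚ                                             ∎)
    where open ≡-Reasoning

  block-sum≡0 : ∀ j → blockSum k r size x α proj j ≡ 0ℚ
  block-sum≡0 j with incl∈image j
  ... | i₀ , floor≡incl = p*q≡0⇒p≡0 ιd≢0 (trans (selected-sum*d (λ i → proj i ≟ j))
    (cong ι (fibre-sum≡0 height<k^D Σz≡0 incl-isCut (λ i → proj i ≟ j) (λ i → proj≡⇔≡incl i j))))
    where
    height<k^D : height x < k ^ suc (height x)
    height<k^D = ℕ.<-trans (ℕ.n<1+n (height x)) (n<k^n 1<k (suc (height x)))
    incl-isCut : IsCut (incl j)
    incl-isCut = subst IsCut floor≡incl (floorCut-isCut (α i₀))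

  label-close : ∀ i → ∣ incl (proj i) - α i ∣ < suc r * suc (height x)
  label-close i =
    subst (λ γ → ∣ γ - α i ∣ < suc r * suc (height x)) (sym (incl∘proj i)) (floorCut-close (α i))

lemmaA1 : (k : ℕ) → 2 ≤ k → (r : ℕ) → (x : Fin r → ℚ) →
    Σ ℕ λ C →
      (α : Fin r → ℕ) → sumℚ r (term k r x α) ≡ 0ℚ →
        Σ ℕ λ s → Σ (Fin r → Fin s) λ block → Σ (Fin s → ℕ) λ γ →
          Surjective _≡_ _≡_ block ×
          ((j : Fin s) → blockSum k r s x α block j ≡ 0ℚ) ×
          ((i : Fin r) → ∣ γ (block i) - α i ∣ < C)
lemmaA1 k 1<k r x = suc r * suc (height x) , λ α Σterm≡0 →
  let open BlockDecomposition k 1<k x α Σterm≡0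
  in size , proj , incl , proj-surjective , block-sum≡0 , label-close
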